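{- Let $\mathbf A=(A,\wedge,\vee,\cdot,\backslash,\slash)$ be a unital residuated binar with multiplicative identity $e$ whose lattice reduct is a Boolean lattice. If $\mathbf A$ satisfies any one of the identities $$x (y\wedge z) = x y\wedge x z,\quad (x\wedge y) z = x z\wedge y z,\quad x\backslash (y\vee z) = x\backslash y\vee x\backslash z,$$ $$(x\vee y)\slash z = x\slash z\vee y\slash z,\quad (x\wedge y)\backslash z = x\backslash z\vee y\backslash z,\quad x\slash (y\wedge z) = x\slash y\vee x\slash z,$$ then $\mathbf A$ is integral (i.e., $x\le e$ for all $x\in A$), and hence $\mathbf A$ is a Boolean algebra (i.e., $x\cdot y=x\wedge y$ for all $x,y\in A$).
   Context: A residuated binar is an algebra $\mathbf A=(A,\wedge,\vee,\cdot,\backslash,\slash)$ where $(A,\wedge,\vee)$ is a lattice, $\cdot$ is a binary operation on $A$ (written $xy$), and for all $x,y,z\in A$: $x\cdot y\le z \iff x\le z\slash y \iff y\le x\backslash z$. It is unital if $\cdot$ has an identity element $e$. Convention: $\cdot$ binds more tightly than $\backslash,\slash$, which bind more tightly than $\wedge,\vee$. -}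

module Defs where

open import Level using (Level; _⊔_) renaming (suc to lsuc)
open import Data.Product using (Σ; _×_; ∃)
open import Data.Sum using (_⊎_)
open import Relation.Binary.Core using (Rel)
open import Algebra.Core using (Op₁; Op₂)
open import Algebra.Definitions using (Congruent₂; Identity)
open import Algebra.Lattice.Structures using (IsLattice; IsBooleanAlgebra)
open import Function.Bundles using (_⇔_)

record UnitalResiduatedBinar (c ℓ : Level) : Set (lsuc (c ⊔ ℓ)) where
  infixr 7 _∧_
  infixr 6 _∨_
  infixl 8 _·_
  infixr 5 _\\_
  infixl 5 _//_
  infix 4 _≈_ _≤_
  field
    Carrier   : Set c
    _≈_       : Rel Carrier ℓ
    _∧_       : Op₂ Carrier
    _∨_       : Op₂ Carrier
    _·_       : Op₂ Carrier
    _\\_      : Op₂ Carrier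
    _//_      : Op₂ Carrier
    e         : Carrier
    isLattice : IsLattice _≈_ _∨_ _∧_
    ·-cong    : Congruent₂ _≈_ _·_
    \\-cong   : Congruent₂ _≈_ _\\_
    //-cong   : Congruent₂ _≈_ _//_
    identity  : Identity _≈_ e _·_

  _≤_ : Rel Carrier ℓ
  x ≤ y = (x ∧ y) ≈ x

  field
    residuatedʳ : ∀ x y z → (x · y ≤ z) ⇔ (x ≤ z // y)
    residuatedˡ : ∀ x y z → (x · y ≤ z) ⇔ (y ≤ x \\ z)

  open IsLattice isLattice public

HasBooleanReduct : ∀ {c ℓ} → UnitalResiduatedBinar c ℓ → Set (c ⊔ ℓ)
HasBooleanReduct A =
  Σ (Op₁ Carrier) λ ¬ → Σ Carrier λ ⊤ → Σ Carrier λ ⊥ →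
    IsBooleanAlgebra _≈_ _∨_ _∧_ ¬ ⊤ ⊥
  where open UnitalResiduatedBinar A

module _ {c ℓ} (A : UnitalResiduatedBinar c ℓ) where
  open UnitalResiduatedBinar A

  Ident1 Ident2 Ident3 Ident4 Ident5 Ident6 : Set (c ⊔ ℓ)
  Ident1 = ∀ x y z → x · (y ∧ z) ≈ x · y ∧ x · z
  Ident2 = ∀ x y z → (x ∧ y) · z ≈ x · z ∧ y · z
  Ident3 = ∀ x y z → x \\ (y ∨ z) ≈ (x \\ y) ∨ (x \\ z)
  Ident4 = ∀ x y z → (x ∨ y) // z ≈ (x // z) ∨ (y // z)
  Ident5 = ∀ x y z → (x ∧ y) \\ z ≈ (x \\ z) ∨ (y \\ z)
  Ident6 = ∀ x y z → x // (y ∧ z) ≈ (x // y) ∨ (x // z)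

  SatisfiesOne : Set (c ⊔ ℓ)
  SatisfiesOne = Ident1 ⊎ Ident2 ⊎ Ident3 ⊎ Ident4 ⊎ Ident5 ⊎ Ident6

  Integral : Set (c ⊔ ℓ)
  Integral = ∀ x → x ≤ e

  MultIsMeet : Set (c ⊔ ℓ)
  MultIsMeet = ∀ x y → x · y ≈ x ∧ y

-- In a Boolean lattice reduct each identity, applied to the complementary pair
-- e, ¬ e together with ⊤ and ⊥, yields ¬ e ≤ ⊥ or e ≤ ⊤ \\ e; either way ⊤ ≤ e,
-- so A is integral. Integrality gives x · y ≤ x ∧ y, and conversely
-- x ∧ y ≤ x · (y ∨ ¬ y) ≤ x · y ∨ x · ¬ y, whose second joinand is disjoint
-- from y. The identities form three mirror-image pairs, exchanged by passing to
-- the opposite binar (x · y ↦ y · x), so one identity of each pair suffices.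
module Submission where

open import Defs
open import Level using (Level)
open import Data.Product using (_×_; _,_; proj₁; proj₂; swap)
open import Data.Sum using (inj₁; inj₂)
open import Function.Bundles using (module Equivalence)
open import Relation.Binary.Definitions using (Minimum; Maximum)
open import Algebra.Lattice.Bundles using (Lattice; BooleanAlgebra)
import Algebra.Lattice.Properties.Lattice as LatticeProperties
import Algebra.Lattice.Properties.BooleanAlgebra as BooleanAlgebraProperties
import Relation.Binary.Lattice as OrderTheoretic
import Relation.Binary.Lattice.Properties.MeetSemilattice as MeetSemilatticeProperties
import Relation.Binary.Reasoning.PartialOrder as PartialOrderReasoning

private
  variable
    c ℓ : Level

opposite : UnitalResiduatedBinar c ℓ → UnitalResiduatedBinar c ℓ
opposite A = record
  { Carrier     = Carrier
  ; _≈_         = _≈_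
  ; _∧_         = _∧_
  ; _∨_         = _∨_
  ; _·_         = λ x y → y · x
  ; _\\_        = λ x y → y // x
  ; _//_        = λ x y → y \\ x
  ; e           = e
  ; isLattice   = isLattice
  ; ·-cong      = λ p q → ·-cong q p
  ; \\-cong     = λ p q → //-cong q p
  ; //-cong     = λ p q → \\-cong q p
  ; identity    = swap identity
  ; residuatedʳ = λ x y z → residuatedˡ y x z
  ; residuatedˡ = λ x y z → residuatedʳ y x z
  }
  where open UnitalResiduatedBinar A

module ResiduatedBinarProperties (A : UnitalResiduatedBinar c ℓ) where

  open UnitalResiduatedBinar A public hiding (_≤_)

  lattice : Lattice c ℓ
  lattice = record { isLattice = isLattice }

  orderTheoreticLattice : OrderTheoretic.Lattice c ℓ ℓ
  orderTheoreticLattice = LatticeProperties.∨-∧-orderTheoreticLattice lattice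

  open OrderTheoretic.Lattice orderTheoreticLattice public
    using (_≤_; poset; x≤x∨y; y≤x∨y; ∨-least; x∧y≤x; x∧y≤y; ∧-greatest)
    renaming ( refl to ≤-refl; trans to ≤-trans
             ; antisym to ≤-antisym; reflexive to ≤-reflexive )
  open MeetSemilatticeProperties (OrderTheoretic.Lattice.meetSemilattice orderTheoreticLattice) public
    using (∧-monotonic)
  open PartialOrderReasoning poset public

  -- Defs orders by x ∧ y ≈ x, the library's order-theoretic lattice by x ≈ x ∧ y.
  ≤⇒∧≈ : ∀ {x y} → x ≤ y → x ∧ y ≈ x
  ≤⇒∧≈ = sym

  ·≤⇒≤// : ∀ {x y z} → x · y ≤ z → x ≤ z // y
  ·≤⇒≤// p = sym (Equivalence.to (residuatedʳ _ _ _) (sym p))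

  ≤//⇒·≤ : ∀ {x y z} → x ≤ z // y → x · y ≤ z
  ≤//⇒·≤ p = sym (Equivalence.from (residuatedʳ _ _ _) (sym p))

  ·≤⇒≤\\ : ∀ {x y z} → x · y ≤ z → y ≤ x \\ z
  ·≤⇒≤\\ p = sym (Equivalence.to (residuatedˡ _ _ _) (sym p))

  ≤\\⇒·≤ : ∀ {x y z} → y ≤ x \\ z → x · y ≤ z
  ≤\\⇒·≤ p = sym (Equivalence.from (residuatedˡ _ _ _) (sym p))

  ·-identityˡ : ∀ x → e · x ≈ x
  ·-identityˡ = proj₁ identity

  ·-identityʳ : ∀ x → x · e ≈ x
  ·-identityʳ = proj₂ identity

  ·-monoˡ-≤ : ∀ {x x′} y → x ≤ x′ → x · y ≤ x′ · y
  ·-monoˡ-≤ y x≤x′ = ≤//⇒·≤ (≤-trans x≤x′ (·≤⇒≤// ≤-refl))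

  ·-monoʳ-≤ : ∀ x {y y′} → y ≤ y′ → x · y ≤ x · y′
  ·-monoʳ-≤ x y≤y′ = ≤\\⇒·≤ (≤-trans y≤y′ (·≤⇒≤\\ ≤-refl))

  ·-distribˡ-∨-≤ : ∀ x y z → x · (y ∨ z) ≤ x · y ∨ x · z
  ·-distribˡ-∨-≤ x y z =
    ≤\\⇒·≤ (∨-least (·≤⇒≤\\ (x≤x∨y _ _)) (·≤⇒≤\\ (y≤x∨y _ _)))

  e\\x≤x : ∀ x → e \\ x ≤ x
  e\\x≤x x = begin
    e \\ x       ≈⟨ ·-identityˡ (e \\ x) ⟨
    e · (e \\ x) ≤⟨ ≤\\⇒·≤ ≤-refl ⟩
    x            ∎

  module _ {⊥ : Carrier} (⊥-minimum : Minimum _≤_ ⊥) where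

    ·-zeroˡ : ∀ x → ⊥ · x ≈ ⊥
    ·-zeroˡ x = ≤-antisym (≤//⇒·≤ (⊥-minimum _)) (⊥-minimum _)

    ·-zeroʳ : ∀ x → x · ⊥ ≈ ⊥
    ·-zeroʳ x = ≤-antisym (≤\\⇒·≤ (⊥-minimum _)) (⊥-minimum _)

  module _ {⊤ : Carrier} (⊤-maximum : Maximum _≤_ ⊤) where

    x≤⊤·x : ∀ x → x ≤ ⊤ · x
    x≤⊤·x x = begin
      x     ≈⟨ ·-identityˡ x ⟨
      e · x ≤⟨ ·-monoˡ-≤ x (⊤-maximum e) ⟩
      ⊤ · x ∎

    x≤x·⊤ : ∀ x → x ≤ x · ⊤
    x≤x·⊤ x = begin
      x     ≈⟨ ·-identityʳ x ⟨
      x · e ≤⟨ ·-monoʳ-≤ x (⊤-maximum e) ⟩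
      x · ⊤ ∎

    ⊤\\x≤x : ∀ x → ⊤ \\ x ≤ x
    ⊤\\x≤x x = ≤-trans (x≤⊤·x (⊤ \\ x)) (≤\\⇒·≤ ≤-refl)

module BooleanReductProperties
  (A : UnitalResiduatedBinar c ℓ) (B : HasBooleanReduct A) where

  open ResiduatedBinarProperties A public

  booleanAlgebra : BooleanAlgebra c ℓ
  booleanAlgebra = record { isBooleanAlgebra = proj₂ (proj₂ (proj₂ B)) }

  open BooleanAlgebra booleanAlgebra public
    using (¬_; ⊤; ⊥; ∧-distribˡ-∨; ∧-complementʳ; ∨-complementʳ)
  open BooleanAlgebraProperties booleanAlgebra using (∧-zeroˡ; ∧-identityʳ)

  ⊥-minimum : Minimum _≤_ ⊥
  ⊥-minimum x = sym (∧-zeroˡ x)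

  ⊤-maximum : Maximum _≤_ ⊤
  ⊤-maximum x = sym (∧-identityʳ x)

  ≤∨-disjoint⇒≤ : ∀ {x y z} → x ≤ y ∨ z → x ∧ z ≤ ⊥ → x ≤ y
  ≤∨-disjoint⇒≤ {x} {y} {z} x≤y∨z x∧z≤⊥ = begin
    x                 ≈⟨ ≤⇒∧≈ x≤y∨z ⟨
    x ∧ (y ∨ z)       ≈⟨ ∧-distribˡ-∨ x y z ⟩
    (x ∧ y) ∨ (x ∧ z) ≤⟨ ∨-least (x∧y≤y x y) (≤-trans x∧z≤⊥ (⊥-minimum y)) ⟩
    y                 ∎

  ¬e≤⊥⇒⊤≤e : ¬ e ≤ ⊥ → ⊤ ≤ e
  ¬e≤⊥⇒⊤≤e ¬e≤⊥ = begin
    ⊤         ≈⟨ ∨-complementʳ e ⟨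
    e ∨ ¬ e   ≤⟨ ∨-least ≤-refl (≤-trans ¬e≤⊥ (⊥-minimum e)) ⟩
    e         ∎

  ident1⇒⊤≤e : Ident1 A → ⊤ ≤ e
  ident1⇒⊤≤e ·-distribˡ-∧ = ¬e≤⊥⇒⊤≤e (begin
    ¬ e                 ≤⟨ ∧-greatest ¬e≤⊤·e (x≤⊤·x ⊤-maximum (¬ e)) ⟩
    ⊤ · e ∧ ⊤ · (¬ e)   ≈⟨ ·-distribˡ-∧ ⊤ e (¬ e) ⟨
    ⊤ · (e ∧ ¬ e)       ≈⟨ ·-cong refl (∧-complementʳ e) ⟩
    ⊤ · ⊥               ≈⟨ ·-zeroʳ ⊥-minimum ⊤ ⟩
    ⊥                   ∎)
    where
    ¬e≤⊤·e : ¬ e ≤ ⊤ · e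
    ¬e≤⊤·e = ≤-trans (⊤-maximum (¬ e)) (≤-reflexive (sym (·-identityʳ ⊤)))

  ident3⇒⊤≤e : Ident3 A → ⊤ ≤ e
  ident3⇒⊤≤e \\-distribˡ-∨ = begin
    ⊤             ≈⟨ ·-identityʳ ⊤ ⟨
    ⊤ · e         ≤⟨ ·-monoʳ-≤ ⊤ e≤⊤\\e ⟩
    ⊤ · (⊤ \\ e)  ≤⟨ ≤\\⇒·≤ ≤-refl ⟩
    e             ∎
    where
    ⊤≤⊤\\e∨⊤\\¬e : ⊤ ≤ (⊤ \\ e) ∨ (⊤ \\ ¬ e)
    ⊤≤⊤\\e∨⊤\\¬e = begin
      ⊤                       ≤⟨ ·≤⇒≤\\ (⊤-maximum (⊤ · ⊤)) ⟩
      ⊤ \\ ⊤                  ≈⟨ \\-cong refl (∨-complementʳ e) ⟨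
      ⊤ \\ (e ∨ ¬ e)          ≈⟨ \\-distribˡ-∨ ⊤ e (¬ e) ⟩
      (⊤ \\ e) ∨ (⊤ \\ ¬ e)   ∎

    e≤⊤\\e : e ≤ ⊤ \\ e
    e≤⊤\\e = ≤∨-disjoint⇒≤ (≤-trans (⊤-maximum e) ⊤≤⊤\\e∨⊤\\¬e) (begin
      e ∧ (⊤ \\ ¬ e)  ≤⟨ ∧-monotonic ≤-refl (⊤\\x≤x ⊤-maximum (¬ e)) ⟩
      e ∧ ¬ e         ≈⟨ ∧-complementʳ e ⟩
      ⊥               ∎)

  ident5⇒⊤≤e : Ident5 A → ⊤ ≤ e
  ident5⇒⊤≤e \\-antidistribʳ-∧ = ¬e≤⊥⇒⊤≤e (begin
    ¬ e          ≤⟨ x≤x·⊤ ⊤-maximum (¬ e) ⟩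
    (¬ e) · ⊤    ≤⟨ ≤\\⇒·≤ ⊤≤¬e\\⊥ ⟩
    ⊥            ∎)
    where
    ⊤≤¬e\\⊥ : ⊤ ≤ ¬ e \\ ⊥
    ⊤≤¬e\\⊥ = begin
      ⊤                       ≤⟨ ·≤⇒≤\\ (≤-reflexive (·-zeroˡ ⊥-minimum ⊤)) ⟩
      ⊥ \\ ⊥                  ≈⟨ \\-cong (∧-complementʳ e) refl ⟨
      (e ∧ ¬ e) \\ ⊥          ≈⟨ \\-antidistribʳ-∧ e (¬ e) ⊥ ⟩
      (e \\ ⊥) ∨ (¬ e \\ ⊥)   ≤⟨ ∨-least (≤-trans (e\\x≤x ⊥) (⊥-minimum _)) ≤-refl ⟩
      ¬ e \\ ⊥                ∎

  ⊤≤e⇒integral : ⊤ ≤ e → Integral A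
  ⊤≤e⇒integral ⊤≤e x = ≤⇒∧≈ (≤-trans (⊤-maximum x) ⊤≤e)

  integral⇒·≈∧ : Integral A → MultIsMeet A
  integral⇒·≈∧ integral x y = ≤-antisym
    (∧-greatest x·y≤x x·y≤y)
    (≤∨-disjoint⇒≤ x∧y≤x·y∨x·¬y (begin
      (x ∧ y) ∧ x · (¬ y)  ≤⟨ ∧-monotonic (x∧y≤y x y) (x·z≤z (¬ y)) ⟩
      y ∧ ¬ y              ≈⟨ ∧-complementʳ y ⟩
      ⊥                    ∎))
    where
    ≤e : ∀ z → z ≤ e
    ≤e z = sym (integral z)

    x·y≤x : x · y ≤ x
    x·y≤x = ≤-trans (·-monoʳ-≤ x (≤e y)) (≤-reflexive (·-identityʳ x))

    x·z≤z : ∀ z → x · z ≤ z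
    x·z≤z z = ≤-trans (·-monoˡ-≤ z (≤e x)) (≤-reflexive (·-identityˡ z))

    x·y≤y : x · y ≤ y
    x·y≤y = x·z≤z y

    x∧y≤x·y∨x·¬y : x ∧ y ≤ x · y ∨ x · (¬ y)
    x∧y≤x·y∨x·¬y = begin
      x ∧ y                ≤⟨ x∧y≤x x y ⟩
      x                    ≈⟨ ·-identityʳ x ⟨
      x · e                ≤⟨ ·-monoʳ-≤ x (⊤-maximum e) ⟩
      x · ⊤                ≈⟨ ·-cong refl (∨-complementʳ y) ⟨
      x · (y ∨ ¬ y)        ≤⟨ ·-distribˡ-∨-≤ x y (¬ y) ⟩
      x · y ∨ x · (¬ y)    ∎

module _ (A : UnitalResiduatedBinar c ℓ) (B : HasBooleanReduct A) where

  open BooleanReductProperties A B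
  private module Opposite = BooleanReductProperties (opposite A) B

  satisfiesOne⇒⊤≤e : SatisfiesOne A → ⊤ ≤ e
  satisfiesOne⇒⊤≤e (inj₁ ident1) = ident1⇒⊤≤e ident1
  satisfiesOne⇒⊤≤e (inj₂ (inj₁ ident2)) =
    Opposite.ident1⇒⊤≤e λ x y z → ident2 y z x
  satisfiesOne⇒⊤≤e (inj₂ (inj₂ (inj₁ ident3))) = ident3⇒⊤≤e ident3
  satisfiesOne⇒⊤≤e (inj₂ (inj₂ (inj₂ (inj₁ ident4)))) =
    Opposite.ident3⇒⊤≤e λ x y z → ident4 y z x
  satisfiesOne⇒⊤≤e (inj₂ (inj₂ (inj₂ (inj₂ (inj₁ ident5))))) = ident5⇒⊤≤e ident5
  satisfiesOne⇒⊤≤e (inj₂ (inj₂ (inj₂ (inj₂ (inj₂ ident6))))) =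
    Opposite.ident5⇒⊤≤e λ x y z → ident6 z x y

lemma4p4 : ∀ {c ℓ} (A : UnitalResiduatedBinar c ℓ) → HasBooleanReduct A →
    SatisfiesOne A → Integral A × MultIsMeet A
lemma4p4 A B satisfiesOne = integral , integral⇒·≈∧ integral
  where
  open BooleanReductProperties A B
  integral : Integral A
  integral = ⊤≤e⇒integral (satisfiesOne⇒⊤≤e A B satisfiesOne)
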